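{- Consider two instances $\mathcal I,\mathcal I'$ on the same set of $n$ candidates and $p$ institutions, with the same estimated-utility vector $\hat u$ (pairwise distinct entries) and the same preference lists $\sigma$. In both instances institution $\ell\in[p]$ has capacity $k_\ell$, except for one institution $\ell^\star$, which has capacity $k_{\ell^\star}$ in $\mathcal I$ and $k_{\ell^\star}+1$ in $\mathcal I'$. Let $M$ and $M'$ be the assignments output by $\mathcal A_{\rm st}$ on $\mathcal I$ and $\mathcal I'$. Then $M$ and $M'$ differ on at most $p$ candidates, and for every institution $\ell\in[p]$ the sets $M^{ -1}(\ell)$ and $M'^{ -1}(\ell)$ differ in at most one candidate.
   Context: Each candidate $i$ has an estimated utility $\hat u_i$ and a preference list $\sigma_i$ (a ranking of the $p$ institutions). An assignment is a partial function from candidates to institutions respecting capacities. Algorithm $\mathcal A_{\rm st}$: consider candidates in decreasing order of $\hat u_i$ and assign each to its most preferred institution that still has a vacant slot (leaving it unassigned if none remains).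
   Formalization: The estimated utilities $\hat u_i$ take rational values. -}

module Defs where

open import Data.Nat using (ℕ; zero; suc; _≤_; pred)
open import Data.Fin using (Fin; _≟_)
open import Data.Fin.Base using ()
open import Data.Maybe using (Maybe; just; nothing)
import Data.Maybe.Properties as MaybeP
open import Data.List using (List; []; _∷_; length; filter; allFin)
open import Data.Product using (_×_)
open import Relation.Nullary using (¬_; Dec; yes; no)

open import Relation.Nullary.Decidable using (_×-dec_; ¬?)
open import Relation.Binary.PropositionalEquality using (_≡_)

Capacity : ℕ → Set
Capacity p = Fin p → ℕ

Assignment : ℕ → ℕ → Set
Assignment n p = Fin n → Maybe (Fin p)

update : {A : Set} {p : ℕ} → (Fin p → A) → Fin p → A → Fin p → A
update f ℓ a ℓ' with ℓ' ≟ ℓ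
... | yes _ = a
... | no  _ = f ℓ'

updateC : {A : Set} {n : ℕ} → (Fin n → A) → Fin n → A → Fin n → A
updateC = update

decr : {p : ℕ} → Capacity p → Fin p → Capacity p
decr r ℓ = update r ℓ (pred (r ℓ))

firstVacant : {p : ℕ} → Capacity p → List (Fin p) → Maybe (Fin p)
firstVacant r [] = nothing
firstVacant r (ℓ ∷ ls) with r ℓ
... | zero  = firstVacant r ls
... | suc _ = just ℓ

greedy : {n p : ℕ} → (Fin n → List (Fin p)) →
         Capacity p → Assignment n p → List (Fin n) → Assignment n p
greedy σ r M [] = M
greedy σ r M (i ∷ is) with firstVacant r (σ i)
... | nothing = greedy σ r M is
... | just ℓ  = greedy σ (decr r ℓ) (updateC M i (just ℓ)) is

-- Algorithm A_st: candidates are processed in the list `order`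
-- (which, in the statement, is required to be the list of all candidates
-- in decreasing order of estimated utility), starting from capacities k
-- and the empty assignment.
Ast : {n p : ℕ} → (Fin n → List (Fin p)) → Capacity p → List (Fin n) → Assignment n p
Ast σ k order = greedy σ k (λ _ → nothing) order

_≟M_ : {p : ℕ} → (a b : Maybe (Fin p)) → Dec (a ≡ b)
_≟M_ = MaybeP.≡-dec _≟_

#differ : {n p : ℕ} → Assignment n p → Assignment n p → ℕ
#differ {n} M M' = length (filter (λ i → ¬? (M i ≟M M' i)) (allFin n))

#lost : {n p : ℕ} → Assignment n p → Assignment n p → Fin p → ℕ
#lost {n} M M' ℓ =
  length (filter (λ i → (M i ≟M just ℓ) ×-dec ¬? (M' i ≟M just ℓ)) (allFin n))

-- Run the greedy algorithm on both instances side by side.  At every moment the remaining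
-- capacities of the second run equal those of the first, except possibly at one institution
-- e (initially ℓ⋆) where they exceed them by one.  A candidate either makes the same choice in
-- both runs, or it takes the extra slot e in the second run while e is already full in the
-- first; then its first-run choice b (if any) becomes the new extra slot, or the surplus
-- disappears.  Hence the candidates on which the runs differ are sent by the second run to
-- pairwise distinct institutions, and by the first run to pairwise distinct ones too: at most
-- p of them, and each institution gains and loses at most one candidate.

module Submission where

open import Defs
open import Data.Nat using (ℕ; zero; suc; pred; _≤_; z≤n; s≤s; ≢-nonZero)
open import Data.Nat.Properties using (suc-pred)
open import Data.Fin using (Fin; _≟_)
open import Data.Maybe using (Maybe; just; nothing)
open import Data.Maybe.Relation.Unary.All as Maybe using (just; nothing)
open import Data.List using (List; []; _∷_; [_]; allFin; length; filter; map)
open import Data.List.Properties using (length-map; length-tabulate; length-removeAt′)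
open import Data.List.Membership.Propositional using (_∈_; _─_)
open import Data.List.Membership.Propositional.Properties using (∈-filter⁻; ∈-map⁺; ∈-allFin)
open import Data.List.Relation.Unary.Any using (here; there)
open import Data.List.Relation.Unary.All as All using (All; _∷_)
open import Data.List.Relation.Unary.AllPairs using (_∷_)
open import Data.List.Relation.Unary.Unique.Propositional using (Unique)
open import Data.List.Relation.Unary.Unique.Propositional.Properties using (allFin⁺; filter⁺)
open import Data.List.Relation.Binary.Permutation.Propositional using (_↭_; ↭-sym; ↭⇒↭ₛ)
import Data.List.Relation.Binary.Permutation.Setoid.Properties as Perm
open import Data.List.Relation.Unary.Linked using (Linked)
open import Data.Rational using (ℚ; _>_)
open import Data.Product using (_×_; _,_; proj₁; proj₂; ∃; ∃₂; curry)
open import Data.Sum using (_⊎_; inj₁; inj₂; map₁)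
open import Function using (_∘_; case_of_)
open import Function.Definitions using (Injective)
open import Relation.Nullary using (yes; no; contradiction)
open import Relation.Nullary.Decidable using (_×-dec_; ¬?; toSum)
open import Relation.Unary using (Decidable)
open import Relation.Binary.Definitions using (DecidableEquality)
open import Relation.Binary.PropositionalEquality
  using (_≡_; _≢_; refl; sym; trans; cong; subst; setoid; module ≡-Reasoning)

private variable
  A B : Set
  n p : ℕ

update-updates : (f : Fin p → A) (i : Fin p) (a : A) → update f i a i ≡ a
update-updates f i a with i ≟ i
... | yes _   = refl
... | no i≢i = contradiction refl i≢i

update-minimal : (f : Fin p → A) (i : Fin p) (a : A) {j : Fin p} → j ≢ i → update f i a j ≡ f j
update-minimal f i a {j} j≢i with j ≟ i
... | yes j≡i = contradiction j≡i j≢i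
... | no _    = refl

∈-─ : {x z : A} {zs : List A} → x ∈ zs → x ≢ z → (z∈zs : z ∈ zs) → x ∈ zs ─ z∈zs
∈-─ (here refl) x≢z (here refl) = contradiction refl x≢z
∈-─ (here refl) x≢z (there _)   = here refl
∈-─ (there x∈)  x≢z (here refl) = x∈
∈-─ (there x∈)  x≢z (there z∈)  = there (∈-─ x∈ x≢z z∈)

length-≤-injection : {xs : List A} {zs : List B} (f : A → B) → Unique xs →
                     (∀ {x} → x ∈ xs → f x ∈ zs) →
                     (∀ {x y} → x ∈ xs → y ∈ xs → f x ≡ f y → x ≡ y) →
                     length xs ≤ length zs
length-≤-injection {xs = []}     f _ _ _ = z≤n
length-≤-injection {xs = x ∷ xs} {zs} f (x∉xs ∷ unique) maps inj =
  subst (suc (length xs) ≤_) (sym (length-removeAt′ zs _))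
    (s≤s (length-≤-injection f unique
            (λ y∈ → ∈-─ (maps (there y∈)) (fy≢fx y∈) fx∈)
            (λ x∈ y∈ → inj (there x∈) (there y∈))))
  where
  fx∈ : f x ∈ zs
  fx∈ = maps (here refl)
  fy≢fx : ∀ {y} → y ∈ xs → f y ≢ f x
  fy≢fx y∈ fy≡fx = All.lookup x∉xs y∈ (inj (here refl) (there y∈) (sym fy≡fx))

length-filter-≤-injection : {P : Fin n → Set} (P? : Decidable P) {zs : List B} (f : Fin n → B) →
                            (∀ {i} → P i → f i ∈ zs) →
                            (∀ {i j} → P i → P j → f i ≡ f j → i ≡ j) →
                            length (filter P? (allFin n)) ≤ length zs
length-filter-≤-injection {n} {P = P} P? f maps inj =
  length-≤-injection f (filter⁺ P? (allFin⁺ n))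
    (maps ∘ holds) (λ i∈ j∈ → inj (holds i∈) (holds j∈))
  where
  holds : ∀ {i} → i ∈ filter P? (allFin n) → P i
  holds = proj₂ ∘ ∈-filter⁻ P? {xs = allFin n}

InjectiveOn : (A → Set) → (A → B) → Set
InjectiveOn P f = ∀ {x y} → P x → P y → f x ≡ f y → x ≡ y

injectiveOn-step : DecidableEquality A → {P Q : A → Set} {f g : A → B} (a : A) →
                   (∀ x → Q x → x ≢ a → P x × g x ≡ f x) →
                   (∀ x → Q a → Q x → x ≢ a → g x ≢ g a) →
                   InjectiveOn P f → InjectiveOn Q g
injectiveOn-step _≟_ a frame clash inj {x} {y} Qx Qy gx≡gy with x ≟ a | y ≟ a
... | yes refl | yes refl = refl
... | yes refl | no y≢a   = contradiction (sym gx≡gy) (clash y Qx Qy y≢a)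
... | no x≢a   | yes refl = contradiction gx≡gy (clash x Qy Qx x≢a)
... | no x≢a   | no y≢a   =
  let (Px , gx≡fx) = frame x Qx x≢a ; (Py , gy≡fy) = frame y Qy y≢a
  in inj Px Py (trans (sym gx≡fx) (trans gx≡gy gy≡fy))

Vacant : Capacity p → Maybe (Fin p) → Set
Vacant r = Maybe.All (λ b → r b ≢ 0)

occupy : Capacity p → Maybe (Fin p) → Capacity p
occupy r nothing  = r
occupy r (just b) = decr r b

Excess : Capacity p → Capacity p → Maybe (Fin p) → Set
Excess r r′ nothing  = ∀ x → r′ x ≡ r x
Excess r r′ (just a) = r′ a ≡ suc (r a) × (∀ x → x ≢ a → r′ x ≡ r x)

Differ : Assignment n p → Assignment n p → Fin n → Set
Differ M M′ i = M i ≢ M′ i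

record Coupled (r r′ : Capacity p) (e : Maybe (Fin p)) (M M′ : Assignment n p) : Set where
  field
    excess              : Excess r r′ e
    differ-M′-full      : ∀ {i} → Differ M M′ i → ∃ λ x → M′ i ≡ just x × r x ≡ 0 × e ≢ just x
    differ-M-full       : ∀ {i y} → Differ M M′ i → M i ≡ just y → r y ≡ 0 ⊎ e ≡ just y
    differ-M′-injective : InjectiveOn (Differ M M′) M′
    differ-M-injective  : InjectiveOn (λ i → Differ M M′ i × M i ≢ nothing) M

decr-zero : (r : Capacity p) (b : Fin p) {x : Fin p} → r x ≡ 0 → decr r b x ≡ 0
decr-zero r b {x} rx≡0 with toSum (x ≟ b)
... | inj₁ refl = trans (update-updates r x _) (cong pred rx≡0)
... | inj₂ x≢b  = trans (update-minimal r b _ x≢b) rx≡0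

occupy-zero : (r : Capacity p) (v : Maybe (Fin p)) {x : Fin p} → r x ≡ 0 → occupy r v x ≡ 0
occupy-zero r nothing  rx≡0 = rx≡0
occupy-zero r (just b) rx≡0 = decr-zero r b rx≡0

decr-cong : (r r′ : Capacity p) (b : Fin p) {x : Fin p} → r′ x ≡ r x → decr r′ b x ≡ decr r b x
decr-cong r r′ b {x} r′x≡rx with toSum (x ≟ b)
... | inj₁ refl =
  trans (update-updates r′ x _) (trans (cong pred r′x≡rx) (sym (update-updates r x _)))
... | inj₂ x≢b  =
  trans (update-minimal r′ b _ x≢b) (trans r′x≡rx (sym (update-minimal r b _ x≢b)))

vacant-≢ : {r : Capacity p} {v : Maybe (Fin p)} {x : Fin p} → Vacant r v → r x ≡ 0 → v ≢ just x
vacant-≢ (just rx≢0) rx≡0 refl = rx≢0 rx≡0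

firstVacant-vacant : (r : Capacity p) (ls : List (Fin p)) → Vacant r (firstVacant r ls)
firstVacant-vacant r []       = nothing
firstVacant-vacant r (ℓ ∷ ls) with r ℓ in rℓ
... | zero  = firstVacant-vacant r ls
... | suc _ = just λ rℓ≡0 → case trans (sym rℓ) rℓ≡0 of λ ()

firstVacant-cong : {r r′ : Capacity p} → (∀ x → r′ x ≡ r x) → ∀ ls →
                   firstVacant r′ ls ≡ firstVacant r ls
firstVacant-cong same [] = refl
firstVacant-cong {r = r} {r′} same (ℓ ∷ ls) with r ℓ | r′ ℓ | same ℓ
... | zero  | _ | refl = firstVacant-cong same ls
... | suc _ | _ | refl = refl

-- Choice r e v v′: while the second run has extra slot e, a candidate picks v in the first run
-- and v′ in the second.
data Choice (r : Capacity p) : Maybe (Fin p) → Maybe (Fin p) → Maybe (Fin p) → Set where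
  agree    : ∀ {e v} → Vacant r v → Choice r e v v
  displace : ∀ {a v} → Vacant r v → r a ≡ 0 → Choice r (just a) v (just a)

choice : {r r′ : Capacity p} {e : Maybe (Fin p)} → Excess r r′ e → ∀ ls →
         Choice r e (firstVacant r ls) (firstVacant r′ ls)
choice {r = r} {e = nothing} same ls rewrite firstVacant-cong same ls =
  agree (firstVacant-vacant r ls)
choice {e = just a} _ [] = agree nothing
choice {r = r} {r′} {just a} (r′a , r′x) (ℓ ∷ ls) with ℓ ≟ a
... | yes refl with r ℓ in rℓ | r′ ℓ | r′a
...   | zero  | _ | refl = displace (firstVacant-vacant r ls) rℓ
...   | suc _ | _ | refl = agree (just λ rℓ≡0 → case trans (sym rℓ) rℓ≡0 of λ ())
choice {r = r} {r′} {just a} (r′a , r′x) (ℓ ∷ ls) | no ℓ≢a with r ℓ in rℓ | r′ ℓ | r′x ℓ ℓ≢a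
...   | zero  | _ | refl = choice (r′a , r′x) ls
...   | suc _ | _ | refl = agree (just λ rℓ≡0 → case trans (sym rℓ) rℓ≡0 of λ ())

excess-decr : {r r′ : Capacity p} {e : Maybe (Fin p)} {b : Fin p} → r b ≢ 0 →
              Excess r r′ e → Excess (decr r b) (decr r′ b) e
excess-decr {r = r} {r′} {nothing} {b} _ same x = decr-cong r r′ b (same x)
excess-decr {r = r} {r′} {just a}  {b} rb≢0 (r′a , r′x) =
  extra (toSum (a ≟ b)) , λ x x≢a → decr-cong r r′ b (r′x x x≢a)
  where
  extra : a ≡ b ⊎ a ≢ b → decr r′ b a ≡ suc (decr r b a)
  extra (inj₁ refl) = begin
    decr r′ a a       ≡⟨ update-updates r′ a _ ⟩
    pred (r′ a)       ≡⟨ cong pred r′a ⟩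
    r a               ≡⟨ sym (suc-pred (r a) {{≢-nonZero rb≢0}}) ⟩
    suc (pred (r a))  ≡⟨ cong suc (sym (update-updates r a _)) ⟩
    suc (decr r a a)  ∎
    where open ≡-Reasoning
  extra (inj₂ a≢b) =
    trans (update-minimal r′ b _ a≢b) (trans r′a (cong suc (sym (update-minimal r b _ a≢b))))

decr-excess : {r r′ : Capacity p} {a : Fin p} → Excess r r′ (just a) → ∀ x → decr r′ a x ≡ r x
decr-excess {r′ = r′} {a} (r′a , r′x) x with toSum (x ≟ a)
... | inj₁ refl = trans (update-updates r′ x _) (cong pred r′a)
... | inj₂ x≢a  = trans (update-minimal r′ a _ x≢a) (r′x x x≢a)

excess-displace : {r r′ : Capacity p} {a : Fin p} {v : Maybe (Fin p)} → Vacant r v →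
                  Excess r r′ (just a) → Excess (occupy r v) (decr r′ a) v
excess-displace nothing excess = decr-excess excess
excess-displace {r = r} {r′} {a} {just b} (just rb≢0) excess =
  extra , λ x x≢b → trans (decr-excess excess x) (sym (update-minimal r b _ x≢b))
  where
  extra : decr r′ a b ≡ suc (decr r b b)
  extra = begin
    decr r′ a b       ≡⟨ decr-excess excess b ⟩
    r b               ≡⟨ sym (suc-pred (r b) {{≢-nonZero rb≢0}}) ⟩
    suc (pred (r b))  ≡⟨ cong suc (sym (update-updates r b _)) ⟩
    suc (decr r b b)  ∎
    where open ≡-Reasoning

differ-update : (M M′ : Assignment n p) (i : Fin n) (v : Maybe (Fin p)) (j : Fin n) →
                Differ (update M i v) (update M′ i v) j → j ≢ i × Differ M M′ j
differ-update M M′ i v j d with toSum (j ≟ i)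
... | inj₁ refl = contradiction (trans (update-updates M j v) (sym (update-updates M′ j v))) d
... | inj₂ j≢i  = j≢i , λ Mj≡M′j →
  d (trans (update-minimal M i v j≢i) (trans Mj≡M′j (sym (update-minimal M′ i v j≢i))))

agree-step : {r r′ : Capacity p} {e : Maybe (Fin p)} {M M′ : Assignment n p} (i : Fin n) {b : Fin p} →
             r b ≢ 0 → Coupled r r′ e M M′ →
             Coupled (decr r b) (decr r′ b) e (update M i (just b)) (update M′ i (just b))
agree-step {p} {n} {r} {r′} {e} {M} {M′} i {b} rb≢0 c = record
  { excess              = excess-decr rb≢0 excess
  ; differ-M′-full      = λ {j} → M′-full j
  ; differ-M-full       = λ {j} → M-full j
  ; differ-M′-injective = injectiveOn-step _≟_ i
      (λ j d j≢i → proj₂ (old j d) , update-minimal M′ i _ j≢i)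
      (λ _ d _ → contradiction refl (proj₁ (old i d)))
      differ-M′-injective
  ; differ-M-injective  = injectiveOn-step _≟_ i
      (λ j (d , Nj≢nothing) j≢i →
         (proj₂ (old j d) , Nj≢nothing ∘ trans (update-minimal M i _ j≢i)) , update-minimal M i _ j≢i)
      (λ _ (d , _) _ → contradiction refl (proj₁ (old i d)))
      differ-M-injective
  }
  where
  open Coupled c
  N N′ : Assignment n p
  N  = update M i (just b)
  N′ = update M′ i (just b)
  old : ∀ j → Differ N N′ j → j ≢ i × Differ M M′ j
  old = differ-update M M′ i (just b)
  M′-full : ∀ j → Differ N N′ j → ∃ λ x → N′ j ≡ just x × decr r b x ≡ 0 × e ≢ just x
  M′-full j d with old j d
  ... | j≢i , d₀ with differ-M′-full d₀
  ... | x , M′j≡x , rx≡0 , e≢x = x , trans (update-minimal M′ i _ j≢i) M′j≡x , decr-zero r b rx≡0 , e≢x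
  M-full : ∀ j {y} → Differ N N′ j → N j ≡ just y → decr r b y ≡ 0 ⊎ e ≡ just y
  M-full j d Nj≡y with old j d
  ... | j≢i , d₀ = map₁ (decr-zero r b) (differ-M-full d₀ (trans (sym (update-minimal M i _ j≢i)) Nj≡y))

-- N is the first run's assignment after the candidate i: either M itself (i stays unassigned)
-- or M updated at i.
displace-step : {r r′ : Capacity p} {a : Fin p} {v : Maybe (Fin p)} {M M′ N : Assignment n p}
                (i : Fin n) → r a ≡ 0 → Vacant r v → N i ≡ v → (∀ {j} → j ≢ i → N j ≡ M j) →
                Coupled r r′ (just a) M M′ → Coupled (occupy r v) (decr r′ a) v N (update M′ i (just a))
displace-step {p} {n} {r} {r′} {a} {v} {M} {M′} {N} i ra≡0 vacant Ni≡v frame c = record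
  { excess              = excess-displace vacant excess
  ; differ-M′-full      = λ {j} → M′-full j
  ; differ-M-full       = λ {j} → M-full j
  ; differ-M′-injective = injectiveOn-step _≟_ i
      (λ j d j≢i → old j d j≢i , update-minimal M′ i _ j≢i) M′-clash differ-M′-injective
  ; differ-M-injective  = injectiveOn-step _≟_ i
      (λ j (d , Nj≢nothing) j≢i → (old j d j≢i , Nj≢nothing ∘ trans (frame j≢i)) , frame j≢i)
      M-clash differ-M-injective
  }
  where
  open Coupled c
  N′ : Assignment n p
  N′ = update M′ i (just a)
  old : ∀ j → Differ N N′ j → j ≢ i → Differ M M′ j
  old j d j≢i Mj≡M′j = d (trans (frame j≢i) (trans Mj≡M′j (sym (update-minimal M′ i _ j≢i))))
  full : ∀ {y} → r y ≡ 0 ⊎ just a ≡ just y → r y ≡ 0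
  full (inj₁ ry≡0) = ry≡0
  full (inj₂ refl) = ra≡0
  M′-full : ∀ j → Differ N N′ j → ∃ λ x → N′ j ≡ just x × occupy r v x ≡ 0 × v ≢ just x
  M′-full j d with toSum (j ≟ i)
  ... | inj₁ refl = a , update-updates M′ i _ , occupy-zero r v ra≡0 , vacant-≢ vacant ra≡0
  ... | inj₂ j≢i with differ-M′-full (old j d j≢i)
  ...   | x , M′j≡x , rx≡0 , _ =
    x , trans (update-minimal M′ i _ j≢i) M′j≡x , occupy-zero r v rx≡0 , vacant-≢ vacant rx≡0
  M-full : ∀ j {y} → Differ N N′ j → N j ≡ just y → occupy r v y ≡ 0 ⊎ v ≡ just y
  M-full j d Nj≡y with toSum (j ≟ i)
  ... | inj₁ refl = inj₂ (trans (sym Ni≡v) Nj≡y)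
  ... | inj₂ j≢i  =
    inj₁ (occupy-zero r v (full (differ-M-full (old j d j≢i) (trans (sym (frame j≢i)) Nj≡y))))
  M′-clash : ∀ j → Differ N N′ i → Differ N N′ j → j ≢ i → N′ j ≢ N′ i
  M′-clash j _ d j≢i N′j≡N′i with differ-M′-full (old j d j≢i)
  ... | x , M′j≡x , _ , a≢x =
    a≢x (trans (sym (update-updates M′ i _))
               (trans (sym N′j≡N′i) (trans (update-minimal M′ i _ j≢i) M′j≡x)))
  M-clash : ∀ j → Differ N N′ i × N i ≢ nothing → Differ N N′ j × N j ≢ nothing → j ≢ i → N j ≢ N i
  M-clash j (_ , Ni≢nothing) (d , _) j≢i Nj≡Ni = taken vacant Ni≡v
    where
    taken : ∀ {w} → Vacant r w → N i ≢ w
    taken nothing     Ni≡nothing = Ni≢nothing Ni≡nothing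
    taken (just rb≢0) Ni≡b       =
      rb≢0 (full (differ-M-full (old j d j≢i) (trans (sym (frame j≢i)) (trans Nj≡Ni Ni≡b))))

unassigned-update : {M : Assignment n p} {i : Fin n} {is : List (Fin n)} (v : Maybe (Fin p)) →
                    All (i ≢_) is → All (λ j → M j ≡ nothing) is →
                    All (λ j → update M i v j ≡ nothing) is
unassigned-update {M = M} {i} v = curry (All.zipWith λ (i≢j , Mj≡nothing) →
  trans (update-minimal M i v (i≢j ∘ sym)) Mj≡nothing)

coupled-greedy : (σ : Fin n → List (Fin p)) {r r′ : Capacity p} {e : Maybe (Fin p)}
                 {M M′ : Assignment n p} (is : List (Fin n)) → Unique is →
                 All (λ j → M j ≡ nothing) is → Coupled r r′ e M M′ →
                 ∃₂ λ ρ ρ′ → ∃ λ e′ → Coupled ρ ρ′ e′ (greedy σ r M is) (greedy σ r′ M′ is)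
coupled-greedy σ [] _ _ c = _ , _ , _ , c
coupled-greedy σ {r} {r′} {M = M} (i ∷ is) (i∉is ∷ unique) (Mi≡nothing ∷ unassigned) c
  with firstVacant r (σ i) | firstVacant r′ (σ i) | choice (Coupled.excess c) (σ i)
... | nothing | _ | agree _ = coupled-greedy σ is unique unassigned c
... | just b  | _ | agree (just rb≢0) =
  coupled-greedy σ is unique (unassigned-update (just b) i∉is unassigned) (agree-step i rb≢0 c)
... | nothing | _ | displace vacant ra≡0 =
  coupled-greedy σ is unique unassigned (displace-step i ra≡0 vacant Mi≡nothing (λ _ → refl) c)
... | just b  | _ | displace vacant ra≡0 =
  coupled-greedy σ is unique (unassigned-update (just b) i∉is unassigned)
    (displace-step i ra≡0 vacant (update-updates M i _) (update-minimal M i _) c)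

coupled-initial : (k : Capacity p) (ℓ⋆ : Fin p) →
                  Coupled {n = n} k (update k ℓ⋆ (suc (k ℓ⋆))) (just ℓ⋆) (λ _ → nothing) (λ _ → nothing)
coupled-initial k ℓ⋆ = record
  { excess              = update-updates k ℓ⋆ _ , λ _ → update-minimal k ℓ⋆ _
  ; differ-M′-full      = λ d → contradiction refl d
  ; differ-M-full       = λ d → contradiction refl d
  ; differ-M′-injective = λ d → contradiction refl d
  ; differ-M-injective  = λ (d , _) → contradiction refl d
  }

module _ {r r′ : Capacity p} {e : Maybe (Fin p)} {M M′ : Assignment n p} (c : Coupled r r′ e M M′) where
  open Coupled c

  #differ-≤ : #differ M M′ ≤ p
  #differ-≤ =
    subst (#differ M M′ ≤_) (trans (length-map just (allFin p)) (length-tabulate (λ x → x)))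
      (length-filter-≤-injection (λ i → ¬? (M i ≟M M′ i)) M′ assigned differ-M′-injective)
    where
    assigned : ∀ {i} → Differ M M′ i → M′ i ∈ map just (allFin p)
    assigned d with differ-M′-full d
    ... | x , M′i≡x , _ = subst (_∈ map just (allFin p)) (sym M′i≡x) (∈-map⁺ just (∈-allFin x))

  #lost-≤ : ∀ ℓ → #lost M M′ ℓ ≤ 1
  #lost-≤ ℓ =
    length-filter-≤-injection (λ i → (M i ≟M just ℓ) ×-dec ¬? (M′ i ≟M just ℓ)) {[ just ℓ ]} M
      (λ (Mi≡ℓ , _) → here Mi≡ℓ)
      (λ lost₁ lost₂ → differ-M-injective (differs lost₁) (differs lost₂))
    where
    differs : ∀ {i} → M i ≡ just ℓ × M′ i ≢ just ℓ → Differ M M′ i × M i ≢ nothing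
    differs (Mi≡ℓ , M′i≢ℓ) =
      (λ Mi≡M′i → M′i≢ℓ (trans (sym Mi≡M′i) Mi≡ℓ)) ,
      (λ Mi≡nothing → case trans (sym Mi≡nothing) Mi≡ℓ of λ ())

  #gained-≤ : ∀ ℓ → #lost M′ M ℓ ≤ 1
  #gained-≤ ℓ =
    length-filter-≤-injection (λ i → (M′ i ≟M just ℓ) ×-dec ¬? (M i ≟M just ℓ)) {[ just ℓ ]} M′
      (λ (M′i≡ℓ , _) → here M′i≡ℓ)
      (λ gained₁ gained₂ → differ-M′-injective (differs gained₁) (differs gained₂))
    where
    differs : ∀ {i} → M′ i ≡ just ℓ × M i ≢ just ℓ → Differ M M′ i
    differs (M′i≡ℓ , Mi≢ℓ) Mi≡M′i = Mi≢ℓ (trans Mi≡M′i M′i≡ℓ)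

↭-allFin⇒Unique : {order : List (Fin n)} → order ↭ allFin n → Unique order
↭-allFin⇒Unique {n} order↭ = Perm.Unique-resp-↭ (setoid (Fin n)) (↭⇒↭ₛ (↭-sym order↭)) (allFin⁺ n)

lemma5 : (n p : ℕ) (û : Fin n → ℚ) (σ : Fin n → List (Fin p))
         (k : Fin p → ℕ) (ℓ⋆ : Fin p) (order : List (Fin n)) →
         Injective _≡_ _≡_ û →
         (∀ i → σ i ↭ allFin p) →
         order ↭ allFin n →
         Linked (λ i j → û i > û j) order →
         let M  = Ast σ k order
             M′ = Ast σ (update k ℓ⋆ (suc (k ℓ⋆))) order
         in #differ M M′ ≤ p
            × (∀ ℓ → #lost M M′ ℓ ≤ 1 × #lost M′ M ℓ ≤ 1)
lemma5 n p û σ k ℓ⋆ order _ _ order↭ _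
  with coupled-greedy σ order (↭-allFin⇒Unique order↭) (All.tabulate λ _ → refl) (coupled-initial k ℓ⋆)
... | _ , _ , _ , c = #differ-≤ c , λ ℓ → #lost-≤ c ℓ , #gained-≤ c ℓ
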